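{- Let $F=GF(8)$, $\alpha$ a primitive element, $\alpha^{ -\infty}=0$, and let $i\neq j$ in $\{ -\infty,0,1,\dots,6\}$. Then $\overline{H}_{\alpha^i}\cap\overline{H}_{\alpha^j}=\{0^8,1^8,x^0,x^1\}$, where $x^0,x^1$ are vectors of weight $4$ whose supports $\Pi^0_{i,j}$ and $\Pi^1_{i,j}$ form a partition of the coordinate set $F$, and $\alpha^i$, $\alpha^j$ belong to different sets of this partition.
   Context: Binary vectors of length $8$ have coordinates indexed by elements of $F$ and are identified with their supports $X\subseteq F$. For $a\in F$, $\overline{H}_a=\{X\subseteq F: |X|\text{ even},\ \sum_{x\in X}(x+a)^3=0\}$. $0^8$ and $1^8$ are the all-zero and all-one vectors. -}

module Defs where

open import Data.Bool using (Bool; true; false; _xor_; _∧_; not; if_then_else_)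
open import Data.Nat using (ℕ; zero; suc)
open import Data.Fin using (Fin; toℕ)
open import Data.Maybe using (Maybe; just; nothing)
open import Data.Product using (_×_; _,_; ∃)
open import Data.List using (List; []; _∷_; filter; length; foldr)
open import Relation.Binary.PropositionalEquality using (_≡_)
open import Relation.Nullary using (¬_)
open import Relation.Nullary.Decidable using (does)
open import Data.Bool.Properties using (T?)

-- GF(8) = GF(2)[x]/(x^3 + x + 1); an element (a0 , a1 , a2) stands for a0 + a1 x + a2 x^2.
-- (GF(8) is unique up to isomorphism, so this concrete model is no loss of generality.)
F : Set
F = Bool × Bool × Bool

0F 1F : F
0F = false , false , false
1F = true , false , false

_+F_ : F → F → F
(a0 , a1 , a2) +F (b0 , b1 , b2) = (a0 xor b0) , (a1 xor b1) , (a2 xor b2)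

-- multiplication by x, using x^3 = x + 1
xtimes : F → F
xtimes (a0 , a1 , a2) = a2 , (a0 xor a2) , a1

scale : Bool → F → F
scale c (b0 , b1 , b2) = (c ∧ b0) , (c ∧ b1) , (c ∧ b2)

_*F_ : F → F → F
(a0 , a1 , a2) *F b = scale a0 b +F (scale a1 (xtimes b) +F scale a2 (xtimes (xtimes b)))

_^F_ : F → ℕ → F
a ^F zero = 1F
a ^F suc n = a *F (a ^F n)

cube : F → F
cube a = a ^F 3

elems : List F
elems = (false , false , false) ∷ (true , false , false) ∷ (false , true , false) ∷ (true , true , false)
      ∷ (false , false , true) ∷ (true , false , true) ∷ (false , true , true) ∷ (true , true , true) ∷ []

Primitive : F → Set
Primitive α = ¬ (α ≡ 0F) × (∀ (y : F) → ¬ (y ≡ 0F) → ∃ λ (k : ℕ) → α ^F k ≡ y)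

-- exponents {-∞, 0, 1, ..., 6}; nothing = -∞
Exp : Set
Exp = Maybe (Fin 7)

pow : F → Exp → F
pow α nothing = 0F
pow α (just k) = α ^F toℕ k

-- binary vectors of length 8 indexed by F, i.e. subsets X ⊆ F (characteristic function)
Vec8 : Set
Vec8 = F → Bool

support : Vec8 → List F
support X = filter (λ x → T? (X x)) elems

weight : Vec8 → ℕ
weight X = length (support X)

zeroVec oneVec : Vec8
zeroVec _ = false
oneVec _ = true

data Even : ℕ → Set where
  even-zero : Even 0
  even-ss : ∀ {n} → Even n → Even (suc (suc n))

InHbar : F → Vec8 → Set
InHbar a X = Even (weight X) × (foldr (λ x s → cube (x +F a) +F s) 0F (support X) ≡ 0F)

-- Write ν X = Σ_{x∈X} 1, s₁ X = Σ_{x∈X} x and s₃ X = Σ_{x∈X} x³.  In characteristic 2,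
-- (x + a)³ = x³ + a x² + a² x + a³ and a x² + a² x is additive in x, so for even X
-- the condition Σ_{x∈X} (x + a)³ = 0 reads s₃ X = a (s₁ X)² + a² s₁ X.  For a ≠ b the two
-- conditions together force s₁ X ∈ {0, a + b}, with s₃ X then determined.  The map
-- X ↦ (ν X, s₁ X, s₃ X) is GF(2)-linear with kernel {0⁸, 1⁸}, so each of the two admissible
-- syndromes is attained by exactly one complementary pair of sets.
module Submission where

open import Defs
open import Data.Bool using (Bool; true; false; not; _xor_; if_then_else_; T)
import Data.Bool.Properties as Bool
open import Data.Bool.Properties using (T?)
open import Data.Fin using (Fin; #_)
import Data.Fin.Properties as Fin
open import Data.List using (List; []; _∷_; foldr; filter; length)
import Data.List.Properties as List
open import Data.Maybe using (Maybe; just; nothing)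
import Data.Maybe.Properties as Maybe
open import Data.Nat using (ℕ; zero; suc)
import Data.Nat.Properties as ℕ
open import Data.Product using (_×_; _,_; ∃₂; proj₁; proj₂)
import Data.Product.Properties as Product
open import Data.Sum using (_⊎_; inj₁; inj₂)
import Data.Sum as Sum
open import Data.Sum.Algebra using (⊎-assoc)
open import Data.Sum.Function.Propositional using (_⊎-⇔_)
open import Data.Vec using (Vec; []; _∷_; lookup; map; fromList)
open import Data.Vec.Properties using (lookup-map)
open import Function using (_∘_; id; case_of_)
open import Function.Bundles using (_⇔_; mk⇔; Equivalence)
import Function.Properties.Equivalence as ⇔
open import Function.Properties.Inverse using (↔⇒⇔)
open import Relation.Binary.Definitions using (DecidableEquality)
open import Relation.Binary.PropositionalEquality
  using (_≡_; _≢_; _≗_; refl; sym; trans; cong; cong₂; subst; module ≡-Reasoning)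
open import Relation.Nullary using (Dec; does; ¬_)
open import Relation.Nullary.Decidable using (map′; from-yes; _×-dec_; _⊎-dec_; _→-dec_; ¬?)

Exhaustible : Set → Set₁
Exhaustible A = {P : A → Set} → (∀ x → Dec (P x)) → Dec (∀ x → P x)

∀-Bool? : Exhaustible Bool
∀-Bool? P? = map′ (λ { (t , f) true → t ; (t , f) false → f }) (λ h → h true , h false)
                  (P? true ×-dec P? false)

∀-×? : {A B : Set} → Exhaustible A → Exhaustible B → Exhaustible (A × B)
∀-×? ∀A? ∀B? P? = map′ (λ h (x , y) → h x y) (λ h x y → h (x , y))
                       (∀A? λ x → ∀B? λ y → P? (x , y))

∀-Maybe? : {A : Set} → Exhaustible A → Exhaustible (Maybe A)
∀-Maybe? ∀A? P? = map′ (λ { (n , j) nothing → n ; (n , j) (just x) → j x })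
                       (λ h → h nothing , λ x → h (just x))
                       (P? nothing ×-dec ∀A? λ x → P? (just x))

∀-Vec? : {A : Set} {n : ℕ} → Exhaustible A → Exhaustible (Vec A n)
∀-Vec? {n = zero}  ∀A? P? = map′ (λ { p [] → p }) (λ h → h []) (P? [])
∀-Vec? {n = suc n} ∀A? P? = map′ (λ { h (x ∷ xs) → h x xs }) (λ h x xs → h (x ∷ xs))
                                (∀A? λ x → ∀-Vec? ∀A? λ xs → P? (x ∷ xs))

∀-F? : Exhaustible F
∀-F? = ∀-×? ∀-Bool? (∀-×? ∀-Bool? ∀-Bool?)

∀-Exp? : Exhaustible Exp
∀-Exp? = ∀-Maybe? λ P? → Fin.all? P?

_≟F_ : DecidableEquality F
_≟F_ = Product.≡-dec Bool._≟_ (Product.≡-dec Bool._≟_ Bool._≟_)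

_≟Exp_ : DecidableEquality Exp
_≟Exp_ = Maybe.≡-dec Fin._≟_

sq : F → F
sq x = x *F x

-- The part of (x + a)³ that is linear over GF(2) in x.
shift : F → F → F
shift a x = (a *F sq x) +F (sq a *F x)

Additive : (F → F) → Set
Additive h = h 0F ≡ 0F × (∀ x y → h (x +F y) ≡ h x +F h y)

additive? : ∀ h → Dec (Additive h)
additive? h = (h 0F ≟F 0F) ×-dec (∀-F? λ x → ∀-F? λ y → h (x +F y) ≟F (h x +F h y))

+F-identityʳ : ∀ x → x +F 0F ≡ x
+F-identityʳ = from-yes (∀-F? λ x → (x +F 0F) ≟F x)

+F-self : ∀ x → x +F x ≡ 0F
+F-self = from-yes (∀-F? λ x → (x +F x) ≟F 0F)

+F-cancelˡ : ∀ x y → x +F (x +F y) ≡ y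
+F-cancelˡ = from-yes (∀-F? λ x → ∀-F? λ y → (x +F (x +F y)) ≟F y)

+F-interchange : ∀ x y z w → (x +F y) +F (z +F w) ≡ (x +F z) +F (y +F w)
+F-interchange = from-yes (∀-F? λ x → ∀-F? λ y → ∀-F? λ z → ∀-F? λ w →
  ((x +F y) +F (z +F w)) ≟F ((x +F z) +F (y +F w)))

+F≡0⇒≡ : ∀ {x y} → x +F y ≡ 0F → x ≡ y
+F≡0⇒≡ {x} {y} e = trans (sym (+F-identityʳ x)) (trans (cong (x +F_) (sym e)) (+F-cancelˡ x y))

*F-identityʳ : ∀ x → x *F 1F ≡ x
*F-identityʳ = from-yes (∀-F? λ x → (x *F 1F) ≟F x)

*F-additive : ∀ c → Additive (c *F_)
*F-additive = from-yes (∀-F? λ c → additive? (c *F_))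

shift-additive : ∀ a → Additive (shift a)
shift-additive = from-yes (∀-F? λ a → additive? (shift a))

cube-+ : ∀ a x → cube (x +F a) ≡ cube x +F (shift a x +F cube a)
cube-+ = from-yes (∀-F? λ a → ∀-F? λ x → cube (x +F a) ≟F (cube x +F (shift a x +F cube a)))

-- For a ≠ b, shift a s + shift b s = (a + b) s (s + a + b).
shift-agree⇒ : ∀ a b s → a ≢ b → shift a s ≡ shift b s → s ≡ 0F ⊎ s ≡ a +F b
shift-agree⇒ = from-yes (∀-F? λ a → ∀-F? λ b → ∀-F? λ s →
  ¬? (a ≟F b) →-dec (shift a s ≟F shift b s) →-dec ((s ≟F 0F) ⊎-dec (s ≟F (a +F b))))

shift-symmetric : ∀ a b → shift a (a +F b) ≡ shift b (a +F b)
shift-symmetric = from-yes (∀-F? λ a → ∀-F? λ b → shift a (a +F b) ≟F shift b (a +F b))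

sumOf : (F → F) → List F → F
sumOf g = foldr (λ x s → g x +F s) 0F

sumOf-cong : ∀ {f g} → f ≗ g → ∀ xs → sumOf f xs ≡ sumOf g xs
sumOf-cong f≗g []       = refl
sumOf-cong f≗g (x ∷ xs) = cong₂ _+F_ (f≗g x) (sumOf-cong f≗g xs)

sumOf-+ : ∀ f g xs → sumOf (λ x → f x +F g x) xs ≡ sumOf f xs +F sumOf g xs
sumOf-+ f g []       = refl
sumOf-+ f g (x ∷ xs) =
  trans (cong ((f x +F g x) +F_) (sumOf-+ f g xs)) (+F-interchange (f x) (g x) _ _)

sumOf-additive : ∀ h → Additive h → ∀ g xs → sumOf (h ∘ g) xs ≡ h (sumOf g xs)
sumOf-additive h (h0 , h+) g []       = sym h0
sumOf-additive h (h0 , h+) g (x ∷ xs) =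
  trans (cong (h (g x) +F_) (sumOf-additive h (h0 , h+) g xs)) (sym (h+ (g x) _))

sumOf-const : ∀ c xs → sumOf (λ _ → c) xs ≡ c *F sumOf (λ _ → 1F) xs
sumOf-const c xs =
  trans (sumOf-cong (λ _ → sym (*F-identityʳ c)) xs)
        (sumOf-additive (c *F_) (*F-additive c) (λ _ → 1F) xs)

sumOf-cubes-+ : ∀ a xs → sumOf (λ x → cube (x +F a)) xs
              ≡ sumOf cube xs +F (shift a (sumOf id xs) +F (cube a *F sumOf (λ _ → 1F) xs))
sumOf-cubes-+ a xs = begin
  sumOf (λ x → cube (x +F a)) xs
    ≡⟨ sumOf-cong (cube-+ a) xs ⟩
  sumOf (λ x → cube x +F (shift a x +F cube a)) xs
    ≡⟨ sumOf-+ cube _ xs ⟩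
  sumOf cube xs +F sumOf (λ x → shift a x +F cube a) xs
    ≡⟨ cong (sumOf cube xs +F_) (sumOf-+ (shift a) (λ _ → cube a) xs) ⟩
  sumOf cube xs +F (sumOf (shift a) xs +F sumOf (λ _ → cube a) xs)
    ≡⟨ cong (sumOf cube xs +F_) (cong₂ _+F_ (sumOf-additive (shift a) (shift-additive a) id xs)
                                             (sumOf-const (cube a) xs)) ⟩
  sumOf cube xs +F (shift a (sumOf id xs) +F (cube a *F sumOf (λ _ → 1F) xs))
    ∎
  where open ≡-Reasoning

even⇔sumOf-1≡0 : ∀ xs → Even (length xs) ⇔ sumOf (λ _ → 1F) xs ≡ 0F
even⇔sumOf-1≡0 []           = mk⇔ (λ _ → refl) (λ _ → even-zero)
even⇔sumOf-1≡0 (_ ∷ [])     = mk⇔ (λ ()) (λ ())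
even⇔sumOf-1≡0 (_ ∷ _ ∷ xs) = mk⇔
  (λ { (even-ss e) → trans (+F-cancelˡ 1F _) (Equivalence.to (even⇔sumOf-1≡0 xs) e) })
  (λ s≡0 → even-ss (Equivalence.from (even⇔sumOf-1≡0 xs)
                                     (trans (sym (+F-cancelˡ 1F _)) s≡0)))

σ : (F → F) → Vec8 → F
σ g X = sumOf g (support X)

ν s₁ s₃ : Vec8 → F
ν  = σ (λ _ → 1F)
s₁ = σ id
s₃ = σ cube

InHbar⇔s₃≡shift : ∀ a X → InHbar a X ⇔ (ν X ≡ 0F × s₃ X ≡ shift a (s₁ X))
InHbar⇔s₃≡shift a X = mk⇔
  (λ { (even , sum≡0) → let ν≡0 = Equivalence.to (even⇔sumOf-1≡0 (support X)) even in
         ν≡0 , +F≡0⇒≡ (trans (sym (sum-cubes ν≡0)) sum≡0) })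
  (λ { (ν≡0 , s₃≡) → Equivalence.from (even⇔sumOf-1≡0 (support X)) ν≡0
                   , trans (sum-cubes ν≡0)
                           (trans (cong (_+F shift a (s₁ X)) s₃≡) (+F-self (shift a (s₁ X)))) })
  where
  sum-cubes : ν X ≡ 0F → σ (λ x → cube (x +F a)) X ≡ s₃ X +F shift a (s₁ X)
  sum-cubes ν≡0 = begin
    σ (λ x → cube (x +F a)) X
      ≡⟨ sumOf-cubes-+ a (support X) ⟩
    s₃ X +F (shift a (s₁ X) +F (cube a *F ν X))
      ≡⟨ cong (λ t → s₃ X +F (shift a (s₁ X) +F (cube a *F t))) ν≡0 ⟩
    s₃ X +F (shift a (s₁ X) +F (cube a *F 0F))
      ≡⟨ cong (λ t → s₃ X +F (shift a (s₁ X) +F t)) (proj₁ (*F-additive (cube a))) ⟩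
    s₃ X +F (shift a (s₁ X) +F 0F)
      ≡⟨ cong (s₃ X +F_) (+F-identityʳ _) ⟩
    s₃ X +F shift a (s₁ X)
      ∎
    where open ≡-Reasoning

HasSyndrome : F → F → Vec8 → Set
HasSyndrome c d X = ν X ≡ 0F × s₁ X ≡ c × s₃ X ≡ d

hasSyndrome? : ∀ c d X → Dec (HasSyndrome c d X)
hasSyndrome? c d X = (ν X ≟F 0F) ×-dec (s₁ X ≟F c) ×-dec (s₃ X ≟F d)

Hbar∩Hbar⇔syndrome : ∀ {a b} → a ≢ b → ∀ X →
  (InHbar a X × InHbar b X) ⇔ (HasSyndrome 0F 0F X ⊎ HasSyndrome (a +F b) (shift a (a +F b)) X)
Hbar∩Hbar⇔syndrome {a} {b} a≢b X = mk⇔ to from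
  where
  to : InHbar a X × InHbar b X → HasSyndrome 0F 0F X ⊎ HasSyndrome (a +F b) (shift a (a +F b)) X
  to (inA , inB) = by-cases (shift-agree⇒ a b (s₁ X) a≢b (trans (sym s₃≡a) s₃≡b))
    where
    ν≡0 : ν X ≡ 0F
    ν≡0 = proj₁ (Equivalence.to (InHbar⇔s₃≡shift a X) inA)
    s₃≡a : s₃ X ≡ shift a (s₁ X)
    s₃≡a = proj₂ (Equivalence.to (InHbar⇔s₃≡shift a X) inA)
    s₃≡b : s₃ X ≡ shift b (s₁ X)
    s₃≡b = proj₂ (Equivalence.to (InHbar⇔s₃≡shift b X) inB)
    by-cases : s₁ X ≡ 0F ⊎ s₁ X ≡ a +F b →
               HasSyndrome 0F 0F X ⊎ HasSyndrome (a +F b) (shift a (a +F b)) X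
    by-cases (inj₁ s₁≡0) =
      inj₁ (ν≡0 , s₁≡0 , trans s₃≡a (trans (cong (shift a) s₁≡0) (proj₁ (shift-additive a))))
    by-cases (inj₂ s₁≡c) = inj₂ (ν≡0 , s₁≡c , trans s₃≡a (cong (shift a) s₁≡c))

  from : HasSyndrome 0F 0F X ⊎ HasSyndrome (a +F b) (shift a (a +F b)) X → InHbar a X × InHbar b X
  from (inj₁ (ν≡0 , s₁≡0 , s₃≡0)) =
      Equivalence.from (InHbar⇔s₃≡shift a X) (ν≡0 , trans s₃≡0 (sym (at-zero a)))
    , Equivalence.from (InHbar⇔s₃≡shift b X) (ν≡0 , trans s₃≡0 (sym (at-zero b)))
    where
    at-zero : ∀ c → shift c (s₁ X) ≡ 0F
    at-zero c = trans (cong (shift c) s₁≡0) (proj₁ (shift-additive c))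
  from (inj₂ (ν≡0 , s₁≡c , s₃≡d)) =
      Equivalence.from (InHbar⇔s₃≡shift a X) (ν≡0 , trans s₃≡d (cong (shift a) (sym s₁≡c)))
    , Equivalence.from (InHbar⇔s₃≡shift b X)
        (ν≡0 , trans s₃≡d (trans (shift-symmetric a b) (cong (shift b) (sym s₁≡c))))

_⊕_ : Vec8 → Vec8 → Vec8
(X ⊕ Y) x = X x xor Y x

complement : Vec8 → Vec8
complement X x = not (X x)

support-cong : ∀ {X Y} → X ≗ Y → support X ≡ support Y
support-cong {X} {Y} X≗Y = List.filter-≐ (λ x → T? (X x)) (λ x → T? (Y x))
  ((λ {x} → subst T (X≗Y x)) , (λ {x} → subst T (sym (X≗Y x)))) elems

σ-cong : ∀ g {X Y} → X ≗ Y → σ g X ≡ σ g Y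
σ-cong g X≗Y = cong (sumOf g) (support-cong X≗Y)

masked : Bool → F → F
masked u t = if u then t else 0F

sumOf-filter : ∀ g (X : Vec8) xs →
  sumOf g (filter (λ x → T? (X x)) xs) ≡ sumOf (λ x → masked (X x) (g x)) xs
sumOf-filter g X []       = refl
sumOf-filter g X (x ∷ xs) with X x
... | true  = cong (g x +F_) (sumOf-filter g X xs)
... | false = sumOf-filter g X xs

masked-xor : ∀ u v t → masked (u xor v) t ≡ masked u t +F masked v t
masked-xor true  true  t = sym (+F-self t)
masked-xor true  false t = sym (+F-identityʳ t)
masked-xor false v     t = refl

σ-⊕ : ∀ g X Y → σ g (X ⊕ Y) ≡ σ g X +F σ g Y
σ-⊕ g X Y = begin
  σ g (X ⊕ Y)
    ≡⟨ sumOf-filter g (X ⊕ Y) elems ⟩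
  sumOf (λ x → masked (X x xor Y x) (g x)) elems
    ≡⟨ sumOf-cong (λ x → masked-xor (X x) (Y x) (g x)) elems ⟩
  sumOf (λ x → gX x +F gY x) elems
    ≡⟨ sumOf-+ gX gY elems ⟩
  sumOf gX elems +F sumOf gY elems
    ≡⟨ sym (cong₂ _+F_ (sumOf-filter g X elems) (sumOf-filter g Y elems)) ⟩
  σ g X +F σ g Y
    ∎
  where
  open ≡-Reasoning
  gX gY : F → F
  gX x = masked (X x) (g x)
  gY x = masked (Y x) (g x)

HasSyndrome-cong : ∀ {c d X Y} → X ≗ Y → HasSyndrome c d X → HasSyndrome c d Y
HasSyndrome-cong X≗Y (ν≡ , s₁≡ , s₃≡) =
    trans (sym (σ-cong (λ _ → 1F) X≗Y)) ν≡
  , trans (sym (σ-cong id X≗Y)) s₁≡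
  , trans (sym (σ-cong cube X≗Y)) s₃≡

index : F → Fin 8
index (false , false , false) = # 0
index (true  , false , false) = # 1
index (false , true  , false) = # 2
index (true  , true  , false) = # 3
index (false , false , true ) = # 4
index (true  , false , true ) = # 5
index (false , true  , true ) = # 6
index (true  , true  , true ) = # 7

decode : Vec Bool 8 → Vec8
decode v x = lookup v (index x)

decode-map : ∀ X → decode (map X (fromList elems)) ≗ X
decode-map X x = trans (lookup-map (index x) X (fromList elems)) (cong X (lookup-elems x))
  where
  lookup-elems : ∀ x → lookup (fromList elems) (index x) ≡ x
  lookup-elems = from-yes (∀-F? λ x → lookup (fromList elems) (index x) ≟F x)

∀-Vec8? : {P : Vec8 → Set} → (∀ {X Y} → X ≗ Y → P X → P Y) →
          (∀ X → Dec (P X)) → Dec (∀ X → P X)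
∀-Vec8? resp P? = map′ (λ h X → resp (decode-map X) (h (map X (fromList elems))))
                       (λ h v → h (decode v))
                       (∀-Vec? ∀-Bool? λ v → P? (decode v))

syndrome-kernel : ∀ X → HasSyndrome 0F 0F X → X ≗ zeroVec ⊎ X ≗ oneVec
syndrome-kernel = from-yes (∀-Vec8? resp λ X →
  hasSyndrome? 0F 0F X →-dec
    ((∀-F? λ x → X x Bool.≟ false) ⊎-dec (∀-F? λ x → X x Bool.≟ true)))
  where
  resp : ∀ {X Y} → X ≗ Y → (HasSyndrome 0F 0F X → X ≗ zeroVec ⊎ X ≗ oneVec) →
         HasSyndrome 0F 0F Y → Y ≗ zeroVec ⊎ Y ≗ oneVec
  resp X≗Y kernel hY =
    Sum.map (λ X≗0 x → trans (sym (X≗Y x)) (X≗0 x)) (λ X≗1 x → trans (sym (X≗Y x)) (X≗1 x))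
            (kernel (HasSyndrome-cong (λ x → sym (X≗Y x)) hY))

xor≡false⇒≡ : ∀ u v → u xor v ≡ false → u ≡ v
xor≡false⇒≡ true  true  _ = refl
xor≡false⇒≡ false false _ = refl

xor≡true⇒≡not : ∀ u v → u xor v ≡ true → u ≡ not v
xor≡true⇒≡not true  false _ = refl
xor≡true⇒≡not false true  _ = refl

complement-syndrome : ∀ {c d Y} → HasSyndrome c d Y → HasSyndrome c d (complement Y)
complement-syndrome {Y = Y} (ν≡ , s₁≡ , s₃≡) =
    trans (σ-complement (λ _ → 1F) refl) ν≡
  , trans (σ-complement id refl) s₁≡
  , trans (σ-complement cube refl) s₃≡
  where
  σ-complement : ∀ g → σ g oneVec ≡ 0F → σ g (complement Y) ≡ σ g Y
  σ-complement g σ1≡0 = begin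
    σ g (complement Y)         ≡⟨ σ-cong g (λ x → sym (trans (Bool.xor-comm (Y x) true)
                                                            (Bool.true-xor (Y x)))) ⟩
    σ g (Y ⊕ oneVec)           ≡⟨ σ-⊕ g Y oneVec ⟩
    σ g Y +F σ g oneVec        ≡⟨ cong (σ g Y +F_) σ1≡0 ⟩
    σ g Y +F 0F                ≡⟨ +F-identityʳ (σ g Y) ⟩
    σ g Y                      ∎
    where open ≡-Reasoning

syndrome-coset : ∀ {c d Y} → HasSyndrome c d Y →
  ∀ X → HasSyndrome c d X ⇔ (X ≗ Y ⊎ X ≗ complement Y)
syndrome-coset {c} {d} {Y} hY@(νY , s₁Y , s₃Y) X = mk⇔ to from
  where
  cancel : ∀ g → σ g X ≡ σ g Y → σ g (X ⊕ Y) ≡ 0F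
  cancel g e = trans (σ-⊕ g X Y) (trans (cong (_+F σ g Y) e) (+F-self (σ g Y)))

  to : HasSyndrome c d X → X ≗ Y ⊎ X ≗ complement Y
  to (νX , s₁X , s₃X) =
    Sum.map (λ D≗0 x → xor≡false⇒≡ (X x) (Y x) (D≗0 x))
            (λ D≗1 x → xor≡true⇒≡not (X x) (Y x) (D≗1 x))
      (syndrome-kernel (X ⊕ Y) ( cancel (λ _ → 1F) (trans νX (sym νY))
                               , cancel id (trans s₁X (sym s₁Y))
                               , cancel cube (trans s₃X (sym s₃Y))))

  from : X ≗ Y ⊎ X ≗ complement Y → HasSyndrome c d X
  from (inj₁ X≗Y)  = HasSyndrome-cong (λ x → sym (X≗Y x)) hY
  from (inj₂ X≗Yᶜ) = HasSyndrome-cong (λ x → sym (X≗Yᶜ x)) (complement-syndrome {c} {d} {Y} hY)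

trace : F → F
trace y = y +F (sq y +F sq (sq y))

-- Π₀ a b = {x : Tr(((x + a)/(a + b))³) = 0}, using y⁶ = y⁻¹ on F*.  Both H̄-conditions are
-- invariant under x ↦ λx + μ, and for (a , b) = (0 , 1) the blocks are the level sets of Tr(x³).
-- Opaque so that it is never evaluated on symbolic arguments.
opaque
  Π₀ : F → F → Vec8
  Π₀ a b x = does (trace (cube ((x +F a) *F ((a +F b) ^F 6))) ≟F 0F)

Π₁ : F → F → Vec8
Π₁ a b = complement (Π₀ a b)

opaque
  unfolding Π₀

  Π₀-syndrome : ∀ a b → a ≢ b → HasSyndrome (a +F b) (shift a (a +F b)) (Π₀ a b)
  Π₀-syndrome = from-yes (∀-F? λ a → ∀-F? λ b →
    ¬? (a ≟F b) →-dec hasSyndrome? (a +F b) (shift a (a +F b)) (Π₀ a b))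

  Π-weights : ∀ a b → a ≢ b → weight (Π₀ a b) ≡ 4 × weight (Π₁ a b) ≡ 4
  Π-weights = from-yes (∀-F? λ a → ∀-F? λ b →
    ¬? (a ≟F b) →-dec (weight (Π₀ a b) ℕ.≟ 4 ×-dec weight (Π₁ a b) ℕ.≟ 4))

  Π₀-separates : ∀ a b → a ≢ b → Π₀ a b a ≢ Π₀ a b b
  Π₀-separates = from-yes (∀-F? λ a → ∀-F? λ b →
    ¬? (a ≟F b) →-dec ¬? (Π₀ a b a Bool.≟ Π₀ a b b))

Hbar∩Hbar⇔blocks : ∀ {a b} → a ≢ b → ∀ X →
  (InHbar a X × InHbar b X) ⇔ ((X ≗ zeroVec) ⊎ (X ≗ oneVec) ⊎ (X ≗ Π₀ a b) ⊎ (X ≗ Π₁ a b))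
Hbar∩Hbar⇔blocks {a} {b} a≢b X =
  ⇔.trans (Hbar∩Hbar⇔syndrome a≢b X)
    (⇔.trans (syndrome-coset (refl , refl , refl) X ⊎-⇔ syndrome-coset (Π₀-syndrome a b a≢b) X)
             (↔⇒⇔ (⊎-assoc _ _ _ _)))

-- F* has prime order 7, so every α ∉ {0, 1} generates it.
pow-injective : ∀ α → α ≢ 0F → α ≢ 1F → ∀ i j → pow α i ≡ pow α j → i ≡ j
pow-injective = from-yes (∀-F? λ α → ¬? (α ≟F 0F) →-dec ¬? (α ≟F 1F) →-dec
  ∀-Exp? λ i → ∀-Exp? λ j → (pow α i ≟F pow α j) →-dec (i ≟Exp j))

primitive⇒≢1 : ∀ {α} → Primitive α → α ≢ 1F
primitive⇒≢1 (_ , generates) refl with generates (false , true , false) (λ ())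
... | k , 1^k≡x = case trans (sym (1F-pow k)) 1^k≡x of λ ()
  where
  1F-pow : ∀ k → 1F ^F k ≡ 1F
  1F-pow zero    = refl
  1F-pow (suc k) rewrite 1F-pow k = refl

mainTheorem6 : (α : F) → Primitive α → (i j : Exp) → ¬ (i ≡ j) →
    ∃₂ λ (x0 x1 : Vec8) →
      (weight x0 ≡ 4) × (weight x1 ≡ 4)
      × (∀ y → x1 y ≡ not (x0 y))
      × ¬ (x0 (pow α i) ≡ x0 (pow α j))
      × (∀ (X : Vec8) → (InHbar (pow α i) X × InHbar (pow α j) X)
           ⇔ ((X ≗ zeroVec) ⊎ (X ≗ oneVec) ⊎ (X ≗ x0) ⊎ (X ≗ x1)))
mainTheorem6 α prim@(α≢0 , _) i j i≢j =
  Π₀ a b , Π₁ a b , proj₁ (Π-weights a b a≢b) , proj₂ (Π-weights a b a≢b) , (λ _ → refl) ,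
  Π₀-separates a b a≢b , Hbar∩Hbar⇔blocks a≢b
  where
  a b : F
  a = pow α i
  b = pow α j

  a≢b : a ≢ b
  a≢b = i≢j ∘ pow-injective α α≢0 (primitive⇒≢1 prim) i j
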